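{- In an AL-monoid $A$, metric betweenness has transitivity $t_2$: for all $a,b,c,d\in A$, if $(a,b,c)M$ and $(a,d,b)M$, then $(a,d,c)M$.
   Context: An AL-monoid (autometrized lattice ordered monoid) is an algebra $(A,+,\vee,\wedge,\ast,0)$ of type $(2,2,2,2,0)$ such that: (1) $(A,+,\vee,\wedge,0)$ is a commutative lattice ordered monoid, i.e. $(A,+,0)$ is a commutative monoid with identity $0$, $(A,\vee,\wedge)$ is a lattice with induced order $\leq$, and $a+(b\vee c)=(a+b)\vee(a+c)$, $a+(b\wedge c)=(a+b)\wedge(a+c)$; (2) $a\ast(a\wedge b)+b=a\vee b$ for all $a,b$; (3) for each $a\in A$ the maps $x\mapsto a+x$, $x\mapsto a\vee x$, $x\mapsto a\wedge x$, $x\mapsto a\ast x$ are contractions with respect to $\ast$, i.e. $f(x)\ast f(y)\leq x\ast y$ for all $x,y$; (4) $[a\ast(a\vee b)]\wedge[b\ast(a\vee b)]=0$ for all $a,b$; and $\ast$ is a metric operation: $a\ast b\geq 0$ with equality iff $a=b$, $a\ast b=b\ast a$, and $a\ast b\leq a\ast c+c\ast b$ for all $a,b,c$. Metric betweenness: $(a,x,b)M$ means $a\ast x+x\ast b=a\ast b$. -}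

module Defs where

open import Level using (Level; suc)
open import Relation.Binary.PropositionalEquality using (_≡_)

-- An AL-monoid (autometrized lattice ordered monoid) (A, +, ∨, ∧, ∗, 0),
-- with equality the propositional equality on the carrier.
record ALMonoid (ℓ : Level) : Set (suc ℓ) where
  infixl 6 _+_
  infixr 5 _∨_
  infixr 6 _∧_
  infixl 7 _∗_
  infix 4 _≤_
  field
    Carrier : Set ℓ
    _+_ _∨_ _∧_ _∗_ : Carrier → Carrier → Carrier
    0# : Carrier

    +-assoc : ∀ a b c → (a + b) + c ≡ a + (b + c)
    +-comm : ∀ a b → a + b ≡ b + a
    +-identityˡ : ∀ a → 0# + a ≡ a

    ∨-assoc : ∀ a b c → (a ∨ b) ∨ c ≡ a ∨ (b ∨ c)
    ∨-comm : ∀ a b → a ∨ b ≡ b ∨ a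
    ∧-assoc : ∀ a b c → (a ∧ b) ∧ c ≡ a ∧ (b ∧ c)
    ∧-comm : ∀ a b → a ∧ b ≡ b ∧ a
    ∨-absorbs-∧ : ∀ a b → a ∨ (a ∧ b) ≡ a
    ∧-absorbs-∨ : ∀ a b → a ∧ (a ∨ b) ≡ a

  _≤_ : Carrier → Carrier → Set ℓ
  a ≤ b = a ∧ b ≡ a

  field
    +-distrib-∨ : ∀ a b c → a + (b ∨ c) ≡ (a + b) ∨ (a + c)
    +-distrib-∧ : ∀ a b c → a + (b ∧ c) ≡ (a + b) ∧ (a + c)

    ax2 : ∀ a b → a ∗ (a ∧ b) + b ≡ a ∨ b

    +-contraction : ∀ a x y → (a + x) ∗ (a + y) ≤ x ∗ y
    ∨-contraction : ∀ a x y → (a ∨ x) ∗ (a ∨ y) ≤ x ∗ y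
    ∧-contraction : ∀ a x y → (a ∧ x) ∗ (a ∧ y) ≤ x ∗ y
    ∗-contraction : ∀ a x y → (a ∗ x) ∗ (a ∗ y) ≤ x ∗ y

    ax4 : ∀ a b → (a ∗ (a ∨ b)) ∧ (b ∗ (a ∨ b)) ≡ 0#

    ∗-nonneg : ∀ a b → 0# ≤ a ∗ b
    ∗-zero⇒eq : ∀ a b → a ∗ b ≡ 0# → a ≡ b
    ∗-self : ∀ a → a ∗ a ≡ 0#
    ∗-comm : ∀ a b → a ∗ b ≡ b ∗ a
    ∗-triangle : ∀ a b c → a ∗ b ≤ a ∗ c + c ∗ b

  Between : Carrier → Carrier → Carrier → Set ℓ
  Between a x b = a ∗ x + x ∗ b ≡ a ∗ b

module Submission where

open import Defs
open import Level using (Level)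
open import Relation.Binary.PropositionalEquality

-- If d lies between a and b, and b between a and c, then the path a–d–b–c has
-- length a ∗ c, so the triangle inequality at b gives a ∗ d + d ∗ c ≤ a ∗ c;
-- the triangle inequality at d gives the reverse inequality.

module ALMonoidProperties {ℓ : Level} (A : ALMonoid ℓ) where

  open ALMonoid A

  ≤-antisym : ∀ {x y} → x ≤ y → y ≤ x → x ≡ y
  ≤-antisym {x} {y} x≤y y≤x = trans (sym x≤y) (trans (∧-comm x y) y≤x)

  +-monoʳ-≤ : ∀ z {x y} → x ≤ y → z + x ≤ z + y
  +-monoʳ-≤ z {x} {y} x≤y = trans (sym (+-distrib-∧ z x y)) (cong (z +_) x≤y)

  Between-path : ∀ {a b c d} → Between a b c → Between a d b →
                 a ∗ d + (d ∗ b + b ∗ c) ≡ a ∗ c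
  Between-path {a} {b} {c} {d} abc adb = begin
    a ∗ d + (d ∗ b + b ∗ c)  ≡⟨ sym (+-assoc (a ∗ d) (d ∗ b) (b ∗ c)) ⟩
    a ∗ d + d ∗ b + b ∗ c    ≡⟨ cong (_+ b ∗ c) adb ⟩
    a ∗ b + b ∗ c            ≡⟨ abc ⟩
    a ∗ c                    ∎
    where open ≡-Reasoning

  Between-trans₂ : ∀ {a b c d} → Between a b c → Between a d b → Between a d c
  Between-trans₂ {a} {b} {c} {d} abc adb = ≤-antisym detour≤direct (∗-triangle a c d)
    where
    detour≤direct : a ∗ d + d ∗ c ≤ a ∗ c
    detour≤direct = subst (a ∗ d + d ∗ c ≤_) (Between-path abc adb)
                          (+-monoʳ-≤ (a ∗ d) (∗-triangle d c b))

mainTheorem6 : ∀ {ℓ : Level} (A : ALMonoid ℓ) → let open ALMonoid A in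
    ∀ a b c d → Between a b c → Between a d b → Between a d c
mainTheorem6 A _ _ _ _ = Between-trans₂
  where open ALMonoidProperties A
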